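{- Let $L$ be an $n\times n$ invertible matrix with integer entries, let $M$ be an $n\times n$ M-matrix, let $N=LM^{ -1}$, and let $R^+=\{x\in\mathbb{R}^n : x\ge 0,\ Nx\in\mathbb{Z}^n\}$. If $x,y\in R^+$ and $y=x-Mz$ for some $z\in\mathbb{Z}^n$, then $h=x-Mz^+$ is also in $R^+$.
   Context: An M-matrix is a real non-singular $n\times n$ matrix $M$ with $M_{ij}\le 0$ for $i\ne j$, $M_{ii}>0$ for all $i$, and all entries of $M^{ -1}$ non-negative. Inequalities between vectors are componentwise. For $z\in\mathbb{Z}^n$, $z^+\in\mathbb{Z}^n_{\ge 0}$ is defined by $z^+_i=z_i$ if $z_i\ge 0$ and $z^+_i=0$ otherwise. -}

module Defs where

open import Level using (Level; _⊔_) renaming (suc to lsuc)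
open import Algebra.Bundles using (CommutativeRing)
open import Relation.Binary.Core using (Rel)
open import Relation.Binary.Structures using (IsTotalOrder)
open import Relation.Nullary using (¬_)
open import Data.Product using (Σ; ∃; _×_)
open import Data.Nat using (ℕ; zero; suc)
open import Data.Integer as ℤ using (ℤ; +_; -[1+_])
open import Data.Fin using (Fin; zero; suc)
open import Relation.Binary.PropositionalEquality using (_≡_)

-- An ordered field (the real numbers are an instance).  The theorem is
-- stated for an arbitrary ordered field, which includes ℝ.
record OrderedField (c ℓ₁ ℓ₂ : Level) : Set (lsuc (c ⊔ ℓ₁ ⊔ ℓ₂)) where
  field
    commutativeRing : CommutativeRing c ℓ₁
  open CommutativeRing commutativeRing public
  field
    _≤_          : Rel Carrier ℓ₂
    isTotalOrder : IsTotalOrder _≈_ _≤_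
    +-mono-≤     : ∀ {a b} c → a ≤ b → (a + c) ≤ (b + c)
    *-nonneg     : ∀ {a b} → 0# ≤ a → 0# ≤ b → 0# ≤ (a * b)
    0≉1          : ¬ (0# ≈ 1#)
    *-inverse    : ∀ a → ¬ (a ≈ 0#) → ∃ λ b → (a * b) ≈ 1#

  _<_ : Rel Carrier (ℓ₁ ⊔ ℓ₂)
  a < b = (a ≤ b) × ¬ (a ≈ b)

_⁺ : ∀ {n} → (Fin n → ℤ) → (Fin n → ℤ)
(z ⁺) i with z i
... | + k     = + k
... | -[1+ k ] = + 0

module _ {c ℓ₁ ℓ₂} (F : OrderedField c ℓ₁ ℓ₂) where
  open OrderedField F hiding (zero)

  Vector : ℕ → Set c
  Vector n = Fin n → Carrier

  Matrix : ℕ → Set c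
  Matrix n = Fin n → Fin n → Carrier

  fromℕ : ℕ → Carrier
  fromℕ zero    = 0#
  fromℕ (suc k) = 1# + fromℕ k

  fromℤ : ℤ → Carrier
  fromℤ (+ k)     = fromℕ k
  fromℤ -[1+ k ] = - fromℕ (suc k)

  ∑ : ∀ {n} → (Fin n → Carrier) → Carrier
  ∑ {zero}  f = 0#
  ∑ {suc n} f = f zero + ∑ (λ i → f (suc i))

  _·_ : ∀ {n} → Matrix n → Matrix n → Matrix n
  (A · B) i j = ∑ (λ k → A i k * B k j)

  _▸_ : ∀ {n} → Matrix n → Vector n → Vector n
  (A ▸ v) i = ∑ (λ k → A i k * v k)

  _-ᵛ_ : ∀ {n} → Vector n → Vector n → Vector n
  (u -ᵛ v) i = u i - v i

  _≈ᵛ_ : ∀ {n} → Vector n → Vector n → Set ℓ₁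
  u ≈ᵛ v = ∀ i → u i ≈ v i

  idMatrix : ∀ {n} → Matrix n
  idMatrix zero    zero    = 1#
  idMatrix zero    (suc j) = 0#
  idMatrix (suc i) zero    = 0#
  idMatrix (suc i) (suc j) = idMatrix i j

  embedMatrix : ∀ {n} → (Fin n → Fin n → ℤ) → Matrix n
  embedMatrix A i j = fromℤ (A i j)

  embedVector : ∀ {n} → (Fin n → ℤ) → Vector n
  embedVector z i = fromℤ (z i)

  IsInverse : ∀ {n} → Matrix n → Matrix n → Set ℓ₁
  IsInverse A B = (∀ i j → (A · B) i j ≈ idMatrix i j)
                × (∀ i j → (B · A) i j ≈ idMatrix i j)

  Invertible : ∀ {n} → Matrix n → Set (c ⊔ ℓ₁)
  Invertible A = Σ (Matrix _) (IsInverse A)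

  record IsMMatrix {n} (M : Matrix n) : Set (c ⊔ ℓ₁ ⊔ ℓ₂) where
    field
      offDiag  : ∀ i j → ¬ (i ≡ j) → M i j ≤ 0#
      diagPos  : ∀ i → 0# < M i i
      inverse  : Matrix n
      isInv    : IsInverse M inverse
      invNonneg : ∀ i j → 0# ≤ inverse i j

  InR⁺ : ∀ {n} → Matrix n → Vector n → Set (ℓ₁ ⊔ ℓ₂)
  InR⁺ N x = (∀ i → 0# ≤ x i) × (Σ (Fin _ → ℤ) λ w → (N ▸ x) ≈ᵛ embedVector w)

-- Write h = x - M z⁺.  Since M is non-positive off the diagonal, the i-th row gives
-- (M z⁺)ᵢ ≤ (M z)ᵢ when zᵢ ≥ 0, so hᵢ ≥ yᵢ ≥ 0, and (M z⁺)ᵢ ≤ 0 when zᵢ < 0, so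
-- hᵢ ≥ xᵢ ≥ 0.  Integrality is linear algebra: N h = N x - L M⁻¹ M z⁺ = N x - L z⁺ ∈ ℤⁿ.
-- Only M⁻¹ M = I and the sign of the off-diagonal entries of M are used.
module Submission where

open import Defs
open import Data.Nat as ℕ using (ℕ)
open import Data.Integer using (ℤ; +_; -[1+_])
open import Data.Fin using (Fin; zero; suc; _≟_)
open import Data.Maybe using (nothing)
open import Data.Product using (Σ; ∃; ∃₂; _,_; proj₁; proj₂)
open import Data.Sum using (_⊎_; inj₁; inj₂)
open import Relation.Nullary using (¬_; yes; no)
open import Function using (_∘_)
open import Relation.Binary.Bundles using (Poset)
open import Relation.Binary.Structures using (IsTotalOrder)
open import Relation.Binary.PropositionalEquality as ≡ using (_≡_)
open import Tactic.RingSolver.Core.AlmostCommutativeRing using (fromCommutativeRing)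
import Tactic.RingSolver.NonReflective as RingSolver
import Algebra.Properties.Ring as RingProperties
import Algebra.Properties.Semiring.Sum as SumProperties
import Algebra.Properties.Semiring.Mult as MultProperties
import Relation.Binary.Reasoning.Setoid as SetoidReasoning
import Relation.Binary.Reasoning.PartialOrder as PosetReasoning

module _ {c ℓ₁ ℓ₂} (F : OrderedField c ℓ₁ ℓ₂) where
  open OrderedField F hiding (zero) renaming (+-mono-≤ to +-monoˡ-≤)
  open RingProperties ring
    using (-0#≈0#; -‿involutive; -‿+-comm; ⁻¹-anti-homo‿-; -1*x≈-x;
           -‿distribˡ-*; -‿distribʳ-*; x[y-z]≈xy-xz; [y-z]x≈yx-zx; xyx⁻¹≈y; \\-leftDividesˡ)
  open SumProperties semiring using (sum; sum-cong-≋; ∑-distrib-+; ∑-comm; *-distribˡ-sum; *-distribʳ-sum)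
  open MultProperties semiring using (_×_; ×-homo-+; ×1-homo-*)
  open RingSolver (fromCommutativeRing commutativeRing (λ _ → nothing))
    using (solve; _⊜_; _⊕_; ⊝_)
  module ≤ = IsTotalOrder isTotalOrder

  poset : Poset c ℓ₁ ℓ₂
  poset = record { isPartialOrder = ≤.isPartialOrder }

  ∑≈sum : ∀ {n} (f : Fin n → Carrier) → ∑ F f ≈ sum f
  ∑≈sum {ℕ.zero}  f = refl
  ∑≈sum {ℕ.suc n} f = +-cong refl (∑≈sum (λ i → f (suc i)))

  ∑-cong : ∀ {n} {f g : Fin n → Carrier} → (∀ i → f i ≈ g i) → ∑ F f ≈ ∑ F g
  ∑-cong {f = f} {g} f≈g = trans (∑≈sum f) (trans (sum-cong-≋ f≈g) (sym (∑≈sum g)))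

  ∑-+ : ∀ {n} (f g : Fin n → Carrier) → ∑ F (λ i → f i + g i) ≈ ∑ F f + ∑ F g
  ∑-+ f g = begin
    ∑ F (λ i → f i + g i)  ≈⟨ ∑≈sum (λ i → f i + g i) ⟩
    sum (λ i → f i + g i)  ≈⟨ ∑-distrib-+ f g ⟩
    sum f + sum g          ≈⟨ +-cong (∑≈sum f) (∑≈sum g) ⟨
    ∑ F f + ∑ F g          ∎
    where open SetoidReasoning setoid

  ∑-neg : ∀ {n} (f : Fin n → Carrier) → ∑ F (λ i → - f i) ≈ - ∑ F f
  ∑-neg {ℕ.zero}  f = sym -0#≈0#
  ∑-neg {ℕ.suc n} f = trans (+-cong refl (∑-neg (λ i → f (suc i)))) (-‿+-comm _ _)

  ∑-- : ∀ {n} (f g : Fin n → Carrier) → ∑ F (λ i → f i - g i) ≈ ∑ F f - ∑ F g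
  ∑-- f g = trans (∑-+ f (λ i → - g i)) (+-cong refl (∑-neg g))

  *-distribˡ-∑ : ∀ {n} a (f : Fin n → Carrier) → a * ∑ F f ≈ ∑ F (λ i → a * f i)
  *-distribˡ-∑ a f = begin
    a * ∑ F f              ≈⟨ *-cong refl (∑≈sum f) ⟩
    a * sum f              ≈⟨ *-distribˡ-sum a f ⟩
    sum (λ i → a * f i)    ≈⟨ ∑≈sum (λ i → a * f i) ⟨
    ∑ F (λ i → a * f i)    ∎
    where open SetoidReasoning setoid

  *-distribʳ-∑ : ∀ {n} a (f : Fin n → Carrier) → ∑ F f * a ≈ ∑ F (λ i → f i * a)
  *-distribʳ-∑ a f = begin
    ∑ F f * a              ≈⟨ *-cong (∑≈sum f) refl ⟩
    sum f * a              ≈⟨ *-distribʳ-sum a f ⟩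
    sum (λ i → f i * a)    ≈⟨ ∑≈sum (λ i → f i * a) ⟨
    ∑ F (λ i → f i * a)    ∎
    where open SetoidReasoning setoid

  ∑-swap : ∀ {m n} (f : Fin m → Fin n → Carrier) →
           ∑ F (λ i → ∑ F (λ j → f i j)) ≈ ∑ F (λ j → ∑ F (λ i → f i j))
  ∑-swap f = begin
    ∑ F (λ i → ∑ F (λ j → f i j))  ≈⟨ ∑-cong (λ i → ∑≈sum (f i)) ⟩
    ∑ F (λ i → sum (λ j → f i j))  ≈⟨ ∑≈sum (λ i → sum (f i)) ⟩
    sum (λ i → sum (λ j → f i j))  ≈⟨ ∑-comm f ⟩
    sum (λ j → sum (λ i → f i j))  ≈⟨ ∑≈sum (λ j → sum (λ i → f i j)) ⟨
    ∑ F (λ j → sum (λ i → f i j))  ≈⟨ ∑-cong (λ j → ∑≈sum (λ i → f i j)) ⟨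
    ∑ F (λ j → ∑ F (λ i → f i j))  ∎
    where open SetoidReasoning setoid

  ▸-cong : ∀ {n} (A : Matrix F n) {u v : Vector F n} →
           _≈ᵛ_ F u v → _≈ᵛ_ F (_▸_ F A u) (_▸_ F A v)
  ▸-cong A u≈v i = ∑-cong (λ k → *-cong refl (u≈v k))

  ▸-distrib-- : ∀ {n} (A : Matrix F n) (u v : Vector F n) i →
                _▸_ F A (_-ᵛ_ F u v) i ≈ _▸_ F A u i - _▸_ F A v i
  ▸-distrib-- A u v i =
    trans (∑-cong (λ k → x[y-z]≈xy-xz (A i k) (u k) (v k)))
          (∑-- (λ k → A i k * u k) (λ k → A i k * v k))

  ·-▸ : ∀ {n} (A B : Matrix F n) (v : Vector F n) i →
        _▸_ F (_·_ F A B) v i ≈ _▸_ F A (_▸_ F B v) i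
  ·-▸ A B v i = begin
    ∑ F (λ k → ∑ F (λ j → A i j * B j k) * v k)    ≈⟨ ∑-cong (λ k → *-distribʳ-∑ (v k) (λ j → A i j * B j k)) ⟩
    ∑ F (λ k → ∑ F (λ j → A i j * B j k * v k))    ≈⟨ ∑-swap (λ k j → A i j * B j k * v k) ⟩
    ∑ F (λ j → ∑ F (λ k → A i j * B j k * v k))    ≈⟨ ∑-cong (λ j → ∑-cong (λ k → *-assoc (A i j) (B j k) (v k))) ⟩
    ∑ F (λ j → ∑ F (λ k → A i j * (B j k * v k)))  ≈⟨ ∑-cong (λ j → *-distribˡ-∑ (A i j) (λ k → B j k * v k)) ⟨
    ∑ F (λ j → A i j * ∑ F (λ k → B j k * v k))    ∎
    where open SetoidReasoning setoid

  idMatrix-▸ : ∀ {n} (v : Vector F n) i → _▸_ F (idMatrix F) v i ≈ v i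
  idMatrix-▸ {ℕ.suc n} v zero = begin
    1# * v zero + ∑ F (λ k → 0# * v (suc k))  ≈⟨ +-cong (*-identityˡ _) (∑-cong {n} (λ k → zeroˡ (v (suc k)))) ⟩
    v zero + ∑ F {n} (λ _ → 0#)               ≈⟨ +-cong refl (∑-zero n) ⟩
    v zero + 0#                               ≈⟨ +-identityʳ _ ⟩
    v zero                                    ∎
    where
    open SetoidReasoning setoid
    ∑-zero : ∀ n → ∑ F {n} (λ _ → 0#) ≈ 0#
    ∑-zero ℕ.zero    = refl
    ∑-zero (ℕ.suc n) = trans (+-identityˡ _) (∑-zero n)
  idMatrix-▸ {ℕ.suc n} v (suc i) =
    trans (+-cong (zeroˡ _) (idMatrix-▸ (λ k → v (suc k)) i)) (+-identityˡ _)

  +-monoʳ-≤ : ∀ {a b} c → a ≤ b → (c + a) ≤ (c + b)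
  +-monoʳ-≤ {a} {b} c a≤b = ≤.≤-respʳ-≈ (+-comm b c) (≤.≤-respˡ-≈ (+-comm a c) (+-monoˡ-≤ c a≤b))

  +-mono-≤ : ∀ {a b c d} → a ≤ b → c ≤ d → (a + c) ≤ (b + d)
  +-mono-≤ {b = b} {c} a≤b c≤d = ≤.trans (+-monoˡ-≤ c a≤b) (+-monoʳ-≤ b c≤d)

  neg-antimono-≤ : ∀ {a b} → a ≤ b → (- b) ≤ (- a)
  neg-antimono-≤ {a} {b} a≤b = begin
    - b                ≈⟨ xyx⁻¹≈y a (- b) ⟨
    a + - b + - a      ≈⟨ +-assoc a (- b) (- a) ⟩
    a + (- b + - a)    ≤⟨ +-monoˡ-≤ (- b + - a) a≤b ⟩
    b + (- b + - a)    ≈⟨ \\-leftDividesˡ b (- a) ⟩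
    - a                ∎
    where open PosetReasoning poset

  nonpos⇒neg-nonneg : ∀ {a} → a ≤ 0# → 0# ≤ (- a)
  nonpos⇒neg-nonneg a≤0 = ≤.≤-respˡ-≈ -0#≈0# (neg-antimono-≤ a≤0)

  neg-nonneg⇒nonpos : ∀ {a} → 0# ≤ (- a) → a ≤ 0#
  neg-nonneg⇒nonpos {a} 0≤-a = ≤.≤-respʳ-≈ -0#≈0# (≤.≤-respˡ-≈ (-‿involutive a) (neg-antimono-≤ 0≤-a))

  0≤1 : 0# ≤ 1#
  0≤1 with ≤.total 0# 1#
  ... | inj₁ 0≤1 = 0≤1
  ... | inj₂ 1≤0 = ≤.≤-respʳ-≈ -1*-1≈1
                     (*-nonneg (nonpos⇒neg-nonneg 1≤0) (nonpos⇒neg-nonneg 1≤0))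
    where
    -1*-1≈1 : - 1# * - 1# ≈ 1#
    -1*-1≈1 = trans (-1*x≈-x (- 1#)) (-‿involutive 1#)

  *-nonpos-nonneg : ∀ {a b} → a ≤ 0# → 0# ≤ b → (a * b) ≤ 0#
  *-nonpos-nonneg {a} {b} a≤0 0≤b = neg-nonneg⇒nonpos
    (≤.≤-respʳ-≈ (sym (-‿distribˡ-* a b)) (*-nonneg (nonpos⇒neg-nonneg a≤0) 0≤b))

  *-nonpos-nonpos : ∀ {a b} → a ≤ 0# → b ≤ 0# → 0# ≤ (a * b)
  *-nonpos-nonpos {a} {b} a≤0 b≤0 = ≤.≤-respʳ-≈ -a*-b≈a*b
    (*-nonneg (nonpos⇒neg-nonneg a≤0) (nonpos⇒neg-nonneg b≤0))
    where
    -a*-b≈a*b : - a * - b ≈ a * b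
    -a*-b≈a*b = trans (sym (-‿distribˡ-* a (- b)))
                  (trans (-‿cong (sym (-‿distribʳ-* a b))) (-‿involutive (a * b)))

  ∑-mono-≤ : ∀ {n} {f g : Fin n → Carrier} → (∀ i → f i ≤ g i) → ∑ F f ≤ ∑ F g
  ∑-mono-≤ {ℕ.zero}  f≤g = ≤.refl
  ∑-mono-≤ {ℕ.suc n} f≤g = +-mono-≤ (f≤g zero) (∑-mono-≤ (λ i → f≤g (suc i)))

  ∑-nonpos : ∀ {n} {f : Fin n → Carrier} → (∀ i → f i ≤ 0#) → ∑ F f ≤ 0#
  ∑-nonpos {ℕ.zero}  f≤0 = ≤.refl
  ∑-nonpos {ℕ.suc n} f≤0 = ≤.≤-respʳ-≈ (+-identityʳ 0#) (+-mono-≤ (f≤0 zero) (∑-nonpos (λ i → f≤0 (suc i))))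

  fromℕ≈×1# : ∀ k → fromℕ F k ≈ k × 1#
  fromℕ≈×1# ℕ.zero    = refl
  fromℕ≈×1# (ℕ.suc k) = +-cong refl (fromℕ≈×1# k)

  fromℕ-homo-+ : ∀ a b → fromℕ F (a ℕ.+ b) ≈ fromℕ F a + fromℕ F b
  fromℕ-homo-+ a b = trans (fromℕ≈×1# (a ℕ.+ b))
    (trans (×-homo-+ 1# a b) (sym (+-cong (fromℕ≈×1# a) (fromℕ≈×1# b))))

  fromℕ-homo-* : ∀ a b → fromℕ F (a ℕ.* b) ≈ fromℕ F a * fromℕ F b
  fromℕ-homo-* a b = trans (fromℕ≈×1# (a ℕ.* b))
    (trans (×1-homo-* a b) (sym (*-cong (fromℕ≈×1# a) (fromℕ≈×1# b))))

  fromℕ-nonneg : ∀ k → 0# ≤ fromℕ F k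
  fromℕ-nonneg ℕ.zero    = ≤.refl
  fromℕ-nonneg (ℕ.suc k) = ≤.≤-respˡ-≈ (+-identityʳ 0#) (+-mono-≤ 0≤1 (fromℕ-nonneg k))

  -- Integers as differences of naturals: closure under + and * then follows from the
  -- homomorphism laws of fromℕ, avoiding the sign case analysis of ℤ's arithmetic.
  IsIntegral : Carrier → Set ℓ₁
  IsIntegral x = ∃₂ λ a b → x ≈ fromℕ F a - fromℕ F b

  fromℕ-integral : ∀ k → IsIntegral (fromℕ F k)
  fromℕ-integral k = k , 0 , sym (trans (+-cong refl -0#≈0#) (+-identityʳ _))

  [a-b]+[c-d]≈[a+c]-[b+d] : ∀ a b c d → (a - b) + (c - d) ≈ (a + c) - (b + d)
  [a-b]+[c-d]≈[a+c]-[b+d] =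
    solve 4 (λ a b c d → ((a ⊕ ⊝ b) ⊕ (c ⊕ ⊝ d)) ⊜ ((a ⊕ c) ⊕ ⊝ (b ⊕ d))) refl

  [a-b]*[c-d]≈[ac+bd]-[ad+bc] : ∀ a b c d → (a - b) * (c - d) ≈ (a * c + b * d) - (a * d + b * c)
  [a-b]*[c-d]≈[ac+bd]-[ad+bc] a b c d = begin
    (a - b) * (c - d)                  ≈⟨ [y-z]x≈yx-zx (c - d) a b ⟩
    a * (c - d) - b * (c - d)          ≈⟨ +-cong (x[y-z]≈xy-xz a c d) (-‿cong (x[y-z]≈xy-xz b c d)) ⟩
    (a * c - a * d) - (b * c - b * d)  ≈⟨ +-cong refl (⁻¹-anti-homo‿- (b * c) (b * d)) ⟩
    (a * c - a * d) + (b * d - b * c)  ≈⟨ [a-b]+[c-d]≈[a+c]-[b+d] (a * c) (a * d) (b * d) (b * c) ⟩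
    (a * c + b * d) - (a * d + b * c)  ∎
    where open SetoidReasoning setoid

  integral-+ : ∀ {x y} → IsIntegral x → IsIntegral y → IsIntegral (x + y)
  integral-+ (a , b , x≈a-b) (c , d , y≈c-d) = a ℕ.+ c , b ℕ.+ d , (begin
    _ + _                                     ≈⟨ +-cong x≈a-b y≈c-d ⟩
    (fromℕ F a - fromℕ F b) + (fromℕ F c - fromℕ F d)
      ≈⟨ [a-b]+[c-d]≈[a+c]-[b+d] (fromℕ F a) (fromℕ F b) (fromℕ F c) (fromℕ F d) ⟩
    (fromℕ F a + fromℕ F c) - (fromℕ F b + fromℕ F d)
      ≈⟨ +-cong (fromℕ-homo-+ a c) (-‿cong (fromℕ-homo-+ b d)) ⟨
    fromℕ F (a ℕ.+ c) - fromℕ F (b ℕ.+ d)      ∎)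
    where open SetoidReasoning setoid

  integral-neg : ∀ {x} → IsIntegral x → IsIntegral (- x)
  integral-neg (a , b , x≈a-b) = b , a , trans (-‿cong x≈a-b) (⁻¹-anti-homo‿- (fromℕ F a) (fromℕ F b))

  integral-- : ∀ {x y} → IsIntegral x → IsIntegral y → IsIntegral (x - y)
  integral-- x∈ℤ y∈ℤ = integral-+ x∈ℤ (integral-neg y∈ℤ)

  integral-* : ∀ {x y} → IsIntegral x → IsIntegral y → IsIntegral (x * y)
  integral-* (a , b , x≈a-b) (c , d , y≈c-d) = a ℕ.* c ℕ.+ b ℕ.* d , a ℕ.* d ℕ.+ b ℕ.* c , (begin
    _ * _                                     ≈⟨ *-cong x≈a-b y≈c-d ⟩
    (fromℕ F a - fromℕ F b) * (fromℕ F c - fromℕ F d)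
      ≈⟨ [a-b]*[c-d]≈[ac+bd]-[ad+bc] (fromℕ F a) (fromℕ F b) (fromℕ F c) (fromℕ F d) ⟩
    (fromℕ F a * fromℕ F c + fromℕ F b * fromℕ F d) - (fromℕ F a * fromℕ F d + fromℕ F b * fromℕ F c)
      ≈⟨ +-cong (homo a c b d) (-‿cong (homo a d b c)) ⟨
    fromℕ F (a ℕ.* c ℕ.+ b ℕ.* d) - fromℕ F (a ℕ.* d ℕ.+ b ℕ.* c)  ∎)
    where
    open SetoidReasoning setoid
    homo : ∀ p q r s → fromℕ F (p ℕ.* q ℕ.+ r ℕ.* s) ≈ fromℕ F p * fromℕ F q + fromℕ F r * fromℕ F s
    homo p q r s = trans (fromℕ-homo-+ (p ℕ.* q) (r ℕ.* s)) (+-cong (fromℕ-homo-* p q) (fromℕ-homo-* r s))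

  fromℤ-integral : ∀ k → IsIntegral (fromℤ F k)
  fromℤ-integral (+ k)     = fromℕ-integral k
  fromℤ-integral -[1+ k ] = integral-neg (fromℕ-integral (ℕ.suc k))

  ∑-integral : ∀ {n} {f : Fin n → Carrier} → (∀ i → IsIntegral (f i)) → IsIntegral (∑ F f)
  ∑-integral {ℕ.zero}  f∈ℤ = fromℕ-integral 0
  ∑-integral {ℕ.suc n} f∈ℤ = integral-+ (f∈ℤ zero) (∑-integral (λ i → f∈ℤ (suc i)))

  fromℕ-difference : ∀ a b → ∃ λ k → fromℕ F a - fromℕ F b ≈ fromℤ F k
  fromℕ-difference ℕ.zero    ℕ.zero    = + 0 , -‿inverseʳ 0#
  fromℕ-difference (ℕ.suc a) ℕ.zero    = + ℕ.suc a , trans (+-cong refl -0#≈0#) (+-identityʳ _)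
  fromℕ-difference ℕ.zero    (ℕ.suc b) = -[1+ b ] , +-identityˡ _
  fromℕ-difference (ℕ.suc a) (ℕ.suc b) =
    let k , a-b≈k = fromℕ-difference a b in k , trans (cancel-1# (fromℕ F a) (fromℕ F b)) a-b≈k
    where
    cancel-1# : ∀ x y → (1# + x) - (1# + y) ≈ x - y
    cancel-1# x y = begin
      (1# + x) - (1# + y)       ≈⟨ +-cong refl (-‿+-comm 1# y) ⟨
      (1# + x) + (- 1# + - y)   ≈⟨ solve 4 (λ o x o′ y → ((o ⊕ x) ⊕ (o′ ⊕ y)) ⊜ ((o ⊕ o′) ⊕ (x ⊕ y))) refl 1# x (- 1#) (- y) ⟩
      (1# - 1#) + (x - y)       ≈⟨ +-cong (-‿inverseʳ 1#) refl ⟩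
      0# + (x - y)              ≈⟨ +-identityˡ (x - y) ⟩
      x - y                     ∎
      where open SetoidReasoning setoid

  integral⇒fromℤ : ∀ {x} → IsIntegral x → ∃ λ k → x ≈ fromℤ F k
  integral⇒fromℤ (a , b , x≈a-b) = let k , a-b≈k = fromℕ-difference a b in k , trans x≈a-b a-b≈k

  ⁺-cases : ∀ {n} (z : Fin n → ℤ) i → (z ⁺) i ≡ z i ⊎ (z ⁺) i ≡ + 0
  ⁺-cases z i with z i
  ... | + k      = inj₁ ≡.refl
  ... | -[1+ k ] = inj₂ ≡.refl

  fromℤ-⁺-nonneg : ∀ {n} (z : Fin n → ℤ) i → 0# ≤ fromℤ F ((z ⁺) i)
  fromℤ-⁺-nonneg z i with z i
  ... | + k      = fromℕ-nonneg k
  ... | -[1+ k ] = ≤.refl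

  nonpos*⁺≤nonpos* : ∀ {a n} (z : Fin n → ℤ) i → a ≤ 0# → (a * fromℤ F ((z ⁺) i)) ≤ (a * fromℤ F (z i))
  nonpos*⁺≤nonpos* z i a≤0 with z i
  ... | + k      = ≤.refl
  ... | -[1+ k ] = ≤.≤-respˡ-≈ (sym (zeroʳ _))
                     (*-nonpos-nonpos a≤0 (neg-nonneg⇒nonpos
                       (≤.≤-respʳ-≈ (sym (-‿involutive _)) (fromℕ-nonneg (ℕ.suc k)))))

  module _ {n} {M : Matrix F n} (offDiag-nonpos : ∀ i j → ¬ i ≡ j → M i j ≤ 0#) (z : Fin n → ℤ) where

    M▸z⁺≤M▸z : ∀ i → (z ⁺) i ≡ z i → _▸_ F M (embedVector F (z ⁺)) i ≤ _▸_ F M (embedVector F z) i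
    M▸z⁺≤M▸z i z⁺ᵢ≡zᵢ = ∑-mono-≤ termwise
      where
      termwise : ∀ k → (M i k * fromℤ F ((z ⁺) k)) ≤ (M i k * fromℤ F (z k))
      termwise k with k ≟ i
      ... | yes ≡.refl rewrite z⁺ᵢ≡zᵢ = ≤.refl
      ... | no k≢i     = nonpos*⁺≤nonpos* z k (offDiag-nonpos i k (k≢i ∘ ≡.sym))

    M▸z⁺≤0 : ∀ i → (z ⁺) i ≡ + 0 → _▸_ F M (embedVector F (z ⁺)) i ≤ 0#
    M▸z⁺≤0 i z⁺ᵢ≡0 = ∑-nonpos termwise
      where
      termwise : ∀ k → (M i k * fromℤ F ((z ⁺) k)) ≤ 0#
      termwise k with k ≟ i
      ... | yes ≡.refl rewrite z⁺ᵢ≡0 = ≤.reflexive (zeroʳ (M i i))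
      ... | no k≢i     = *-nonpos-nonneg (offDiag-nonpos i k (k≢i ∘ ≡.sym)) (fromℤ-⁺-nonneg z k)

    x-M▸z⁺-nonneg : ∀ {x y : Vector F n} → (∀ i → 0# ≤ x i) → (∀ i → 0# ≤ y i) →
                    _≈ᵛ_ F y (_-ᵛ_ F x (_▸_ F M (embedVector F z))) →
                    ∀ i → 0# ≤ _-ᵛ_ F x (_▸_ F M (embedVector F (z ⁺))) i
    x-M▸z⁺-nonneg {x} {y} x≥0 y≥0 y≈x-Mz i with ⁺-cases z i
    ... | inj₁ z⁺ᵢ≡zᵢ = begin
      0#                                          ≤⟨ y≥0 i ⟩
      y i                                         ≈⟨ y≈x-Mz i ⟩
      x i - _▸_ F M (embedVector F z) i           ≤⟨ +-monoʳ-≤ (x i) (neg-antimono-≤ (M▸z⁺≤M▸z i z⁺ᵢ≡zᵢ)) ⟩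
      x i - _▸_ F M (embedVector F (z ⁺)) i       ∎
      where open PosetReasoning poset
    ... | inj₂ z⁺ᵢ≡0 = begin
      0#                                          ≤⟨ x≥0 i ⟩
      x i                                         ≈⟨ +-identityʳ (x i) ⟨
      x i + 0#                                    ≤⟨ +-monoʳ-≤ (x i) (nonpos⇒neg-nonneg (M▸z⁺≤0 i z⁺ᵢ≡0)) ⟩
      x i - _▸_ F M (embedVector F (z ⁺)) i       ∎
      where open PosetReasoning poset

  leftInverse-▸ : ∀ {n} {B M : Matrix F n} → (∀ i j → _·_ F B M i j ≈ idMatrix F i j) →
                  ∀ v j → _▸_ F B (_▸_ F M v) j ≈ v j
  leftInverse-▸ {B = B} {M} BM≈I v j = begin
    _▸_ F B (_▸_ F M v) j        ≈⟨ ·-▸ B M v j ⟨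
    _▸_ F (_·_ F B M) v j        ≈⟨ ∑-cong (λ k → *-cong (BM≈I j k) refl) ⟩
    _▸_ F (idMatrix F) v j       ≈⟨ idMatrix-▸ v j ⟩
    v j                          ∎
    where open SetoidReasoning setoid

  integral-▸-sub : ∀ {n} (L : Fin n → Fin n → ℤ) {B M : Matrix F n} →
                   (∀ i j → _·_ F B M i j ≈ idMatrix F i j) →
                   let N = _·_ F (embedMatrix F L) B in
                   (x : Vector F n) (w u : Fin n → ℤ) → _≈ᵛ_ F (_▸_ F N x) (embedVector F w) →
                   Σ (Fin n → ℤ) λ w′ → _≈ᵛ_ F (_▸_ F N (_-ᵛ_ F x (_▸_ F M (embedVector F u)))) (embedVector F w′)
  integral-▸-sub L {B} {M} BM≈I x w u Nx≈w =
    (λ i → proj₁ (integral⇒fromℤ (integral i))) , (λ i → trans (N▸h≈w-Lu i) (proj₂ (integral⇒fromℤ (integral i))))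
    where
    L̂ = embedMatrix F L
    N = _·_ F L̂ B
    û = embedVector F u

    N▸h≈w-Lu : ∀ i → _▸_ F N (_-ᵛ_ F x (_▸_ F M û)) i ≈ fromℤ F (w i) - _▸_ F L̂ û i
    N▸h≈w-Lu i = begin
      _▸_ F N (_-ᵛ_ F x (_▸_ F M û)) i                 ≈⟨ ▸-distrib-- N x (_▸_ F M û) i ⟩
      _▸_ F N x i - _▸_ F N (_▸_ F M û) i              ≈⟨ +-cong (Nx≈w i) (-‿cong (·-▸ L̂ B (_▸_ F M û) i)) ⟩
      fromℤ F (w i) - _▸_ F L̂ (_▸_ F B (_▸_ F M û)) i  ≈⟨ +-cong refl (-‿cong (▸-cong L̂ (leftInverse-▸ BM≈I û) i)) ⟩
      fromℤ F (w i) - _▸_ F L̂ û i                      ∎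
      where open SetoidReasoning setoid

    integral : ∀ i → IsIntegral (fromℤ F (w i) - _▸_ F L̂ û i)
    integral i = integral-- (fromℤ-integral (w i))
                   (∑-integral (λ k → integral-* (fromℤ-integral (L i k)) (fromℤ-integral (u k))))

mainTheorem3 : ∀ {c ℓ₁ ℓ₂} (F : OrderedField c ℓ₁ ℓ₂) (n : ℕ)
    (L : Fin n → Fin n → ℤ) → Invertible F (embedMatrix F L) →
    (M : Matrix F n) (mM : IsMMatrix F M) →
    let N = _·_ F (embedMatrix F L) (IsMMatrix.inverse mM) in
    (x y : Vector F n) → InR⁺ F N x → InR⁺ F N y →
    (z : Fin n → ℤ) → _≈ᵛ_ F y (_-ᵛ_ F x (_▸_ F M (embedVector F z))) →
    InR⁺ F N (_-ᵛ_ F x (_▸_ F M (embedVector F (z ⁺))))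
mainTheorem3 F n L _ M mM x y (x≥0 , w , Nx≈w) (y≥0 , _) z y≈x-Mz =
  x-M▸z⁺-nonneg F offDiag z x≥0 y≥0 y≈x-Mz ,
  integral-▸-sub F L (proj₂ isInv) x w (z ⁺) Nx≈w
  where open IsMMatrix mM
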